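{- For every $\textit{LTL}_f$ formula $\phi$, if the propositional formula $\mathit{off}(\phi)$ is satisfiable (i.e. there is $A\in\Sigma$ with $A\models\mathit{off}(\phi)$), then $\phi$ is satisfiable as an $\textit{LTL}_f$ formula.
   Context: Fix a finite set $\mathcal{P}$ of atomic propositions; $L=\mathcal{P}\cup\{\neg a: a\in\mathcal{P}\}$ is the set of literals and $\Sigma=2^{L}$. $\textit{LTL}_f$ formulas are in negation normal form: $\phi::=\mathsf{tt}\mid\mathsf{ff}\mid \ell\mid \phi\wedge\phi\mid\phi\vee\phi\mid X\phi\mid X_w\phi\mid \phi U\phi\mid\phi R\phi$, $\ell\in L$. Semantics on finite traces $\eta=\omega_0\ldots\omega_n\in\Sigma^*$ ($n\ge0$, $|\eta|=n+1$, $\eta_i=\omega_i\ldots\omega_n$): $\eta\models\mathsf{tt}$, $\eta\not\models\mathsf{ff}$; $\eta\models\ell$ iff $\ell\in\omega_0$; $\wedge,\vee$ as usual; $\eta\models X\psi$ iff $|\eta|>1$ and $\eta_1\models\psi$; $\eta\models X_w\psi$ iff $|\eta|=1$ or ($|\eta|>1$ and $\eta_1\models\psi$); $\eta\models\phi_1U\phi_2$ iff some $0\le i<|\eta|$ has $\eta_i\models\phi_2$ and $\eta_j\models\phi_1$ for all $j<i$; $\eta\models\phi_1R\phi_2$ iff either $\eta_i\models\phi_2$ for all $0\le i<|\eta|$, or some $0\le i<|\eta|$ has $\eta_i\models\phi_1$ and $\eta_j\models\phi_2$ for all $j\le i$. $\phi$ is satisfiable iff some finite trace satisfies it. A letter $A\in\Sigma$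 is identified with the length-one trace, so $A\models\alpha$ is defined for propositional $\alpha$. Obligation formulas $\mathit{off},\mathit{ofr},\mathit{ofg}$ (propositional formulas), defined by induction; for $\mathit{ofx}$ ranging over all three: $\mathit{ofx}(\mathsf{tt})=\mathsf{tt}$, $\mathit{ofx}(\mathsf{ff})=\mathsf{ff}$, $\mathit{ofx}(\ell)=\ell$ for literals; $\mathit{ofx}(\phi_1\wedge\phi_2)=\mathit{ofx}(\phi_1)\wedge\mathit{ofx}(\phi_2)$; $\mathit{ofx}(\phi_1\vee\phi_2)=\mathit{ofx}(\phi_1)\vee\mathit{ofx}(\phi_2)$; $\mathit{ofx}(\phi_1U\phi_2)=\mathit{ofx}(\phi_2)$. For Next: $\mathit{off}(X\phi_2)=\mathit{off}(\phi_2)$, $\mathit{ofr}(X\phi_2)=\mathsf{ff}$, $\mathit{ofg}(X\phi_2)=\mathsf{ff}$; $\mathit{off}(X_w\phi_2)=\mathit{off}(\phi_2)$, $\mathit{ofr}(X_w\phi_2)=\mathsf{ff}$, $\mathit{ofg}(X_w\phi_2)=\mathsf{tt}$. For Release: $\mathit{off}(\phi_1R\phi_2)=\mathit{ofr}(\phi_2)$, $\mathit{ofr}(\phi_1R\phi_2)=\mathit{ofr}(\phi_2)$, $\mathit{ofg}(\phi_1R\phi_2)=\mathit{ofg}(\phi_2)$. -}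

module Defs where

open import Data.Nat using (ℕ; zero; suc; _<_; _≤_; _>_)
open import Data.Fin using (Fin)
open import Data.Bool using (Bool; true)
open import Data.List using (List; []; _∷_; length)
open import Data.Product using (Σ; ∃; _×_; _,_)
open import Data.Sum using (_⊎_)
open import Data.Unit using (⊤)
open import Data.Empty using (⊥)
open import Relation.Binary.PropositionalEquality using (_≡_)

data Lit (n : ℕ) : Set where
  pos : Fin n → Lit n
  neg : Fin n → Lit n

-- Σ = 2^L : a letter is an arbitrary subset of literals (characteristic function).
Letter : ℕ → Set
Letter n = Lit n → Bool

_∈L_ : ∀ {n} → Lit n → Letter n → Set
ℓ ∈L A = A ℓ ≡ true

-- LTLf formulas in negation normal form.
data Form (n : ℕ) : Set where
  tt ff : Form n
  lit : Lit n → Form n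
  _∧_ _∨_ : Form n → Form n → Form n
  X Xw : Form n → Form n
  _U_ _R_ : Form n → Form n → Form n

-- Finite nonempty traces η = ω₀ ω₁ … ωₙ, stored as first letter and the rest.
record Trace (n : ℕ) : Set where
  constructor _◂_
  field
    hd : Letter n
    tl : List (Letter n)
open Trace public

len : ∀ {n} → Trace n → ℕ
len (a ◂ as) = suc (length as)

-- η_i (suffix starting at position i); for i ≥ |η| returns the last letter
-- (only ever used with i < |η|).
suffix : ∀ {n} → Trace n → ℕ → Trace n
suffix η zero = η
suffix (a ◂ []) (suc i) = a ◂ []
suffix (a ◂ (b ∷ bs)) (suc i) = suffix (b ◂ bs) i

infix 4 _⊨_
_⊨_ : ∀ {n} → Trace n → Form n → Set
η ⊨ tt = ⊤
η ⊨ ff = ⊥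
η ⊨ lit ℓ = ℓ ∈L hd η
η ⊨ (φ ∧ ψ) = (η ⊨ φ) × (η ⊨ ψ)
η ⊨ (φ ∨ ψ) = (η ⊨ φ) ⊎ (η ⊨ ψ)
η ⊨ X φ = (len η > 1) × (suffix η 1 ⊨ φ)
η ⊨ Xw φ = (len η ≡ 1) ⊎ ((len η > 1) × (suffix η 1 ⊨ φ))
η ⊨ (φ U ψ) = Σ ℕ λ i → (i < len η) × (suffix η i ⊨ ψ)
                 × (∀ j → j < i → suffix η j ⊨ φ)
η ⊨ (φ R ψ) = (∀ i → i < len η → suffix η i ⊨ ψ)
              ⊎ (Σ ℕ λ i → (i < len η) × (suffix η i ⊨ φ)
                   × (∀ j → j ≤ i → suffix η j ⊨ ψ))

-- A letter A is identified with the length-one trace.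
_⊨L_ : ∀ {n} → Letter n → Form n → Set
A ⊨L φ = (A ◂ []) ⊨ φ

ofr : ∀ {n} → Form n → Form n
ofr tt = tt
ofr ff = ff
ofr (lit ℓ) = lit ℓ
ofr (φ ∧ ψ) = ofr φ ∧ ofr ψ
ofr (φ ∨ ψ) = ofr φ ∨ ofr ψ
ofr (X φ) = ff
ofr (Xw φ) = ff
ofr (φ U ψ) = ofr ψ
ofr (φ R ψ) = ofr ψ

ofg : ∀ {n} → Form n → Form n
ofg tt = tt
ofg ff = ff
ofg (lit ℓ) = lit ℓ
ofg (φ ∧ ψ) = ofg φ ∧ ofg ψ
ofg (φ ∨ ψ) = ofg φ ∨ ofg ψ
ofg (X φ) = ff
ofg (Xw φ) = tt
ofg (φ U ψ) = ofg ψ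
ofg (φ R ψ) = ofg ψ

off : ∀ {n} → Form n → Form n
off tt = tt
off ff = ff
off (lit ℓ) = lit ℓ
off (φ ∧ ψ) = off φ ∧ off ψ
off (φ ∨ ψ) = off φ ∨ off ψ
off (X φ) = off φ
off (Xw φ) = off φ
off (φ U ψ) = off ψ
off (φ R ψ) = ofr ψ

Satisfiable : ∀ {n} → Form n → Set
Satisfiable φ = Σ (Trace _) λ η → η ⊨ φ

module Submission where

-- If the letter A satisfies off φ, then φ holds on the constant trace A^(k+1) for k at least
-- the Next-depth of φ: an Until is fulfilled at once by its right argument, each X / Xw steps
-- one letter forward, and a Release is fulfilled by its right argument holding forever —
-- which it does, because ofr replaces every Next by ff and so only speaks about the current
-- letter, and every suffix of a constant trace starts with A.

open import Defs
open import Data.Nat using (ℕ; zero; suc; _⊔_; _≤_; _∸_; z≤n; s≤s)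
open import Data.Nat.Properties using (≤-refl; m⊔n≤o⇒m≤o; m⊔n≤o⇒n≤o)
open import Data.Product using (Σ; _,_)
open import Data.Sum using (inj₁; inj₂)
open import Data.List using (replicate)
open import Data.Unit using (tt)
open import Relation.Binary.PropositionalEquality using (_≡_; refl; subst; sym)

constantTrace : ∀ {n} → Letter n → ℕ → Trace n
constantTrace A k = A ◂ replicate k A

suffix-constantTrace : ∀ {n} (A : Letter n) k i →
                       suffix (constantTrace A k) i ≡ constantTrace A (k ∸ i)
suffix-constantTrace A k       zero    = refl
suffix-constantTrace A zero    (suc i) = refl
suffix-constantTrace A (suc k) (suc i) = suffix-constantTrace A k i

ofr⇒constantTrace⊨ : ∀ {n} {A : Letter n} (φ : Form n) k →
                     A ⊨L ofr φ → constantTrace A k ⊨ φ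
ofr⇒constantTrace⊨ tt      k _          = tt
ofr⇒constantTrace⊨ (lit ℓ) k A∈ℓ        = A∈ℓ
ofr⇒constantTrace⊨ (φ ∧ ψ) k (Aφ , Aψ)  = ofr⇒constantTrace⊨ φ k Aφ , ofr⇒constantTrace⊨ ψ k Aψ
ofr⇒constantTrace⊨ (φ ∨ ψ) k (inj₁ Aφ)  = inj₁ (ofr⇒constantTrace⊨ φ k Aφ)
ofr⇒constantTrace⊨ (φ ∨ ψ) k (inj₂ Aψ)  = inj₂ (ofr⇒constantTrace⊨ ψ k Aψ)
ofr⇒constantTrace⊨ (φ U ψ) k Aψ         = 0 , s≤s z≤n , ofr⇒constantTrace⊨ ψ k Aψ , λ _ ()
ofr⇒constantTrace⊨ {A = A} (φ R ψ) k Aψ = inj₁ λ i _ →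
  subst (_⊨ ψ) (sym (suffix-constantTrace A k i)) (ofr⇒constantTrace⊨ ψ (k ∸ i) Aψ)

nextDepth : ∀ {n} → Form n → ℕ
nextDepth tt      = 0
nextDepth ff      = 0
nextDepth (lit _) = 0
nextDepth (φ ∧ ψ) = nextDepth φ ⊔ nextDepth ψ
nextDepth (φ ∨ ψ) = nextDepth φ ⊔ nextDepth ψ
nextDepth (X φ)   = suc (nextDepth φ)
nextDepth (Xw φ)  = suc (nextDepth φ)
nextDepth (φ U ψ) = nextDepth ψ
nextDepth (φ R ψ) = 0

off⇒constantTrace⊨ : ∀ {n} {A : Letter n} (φ : Form n) k → nextDepth φ ≤ k →
                     A ⊨L off φ → constantTrace A k ⊨ φ
off⇒constantTrace⊨ tt      k _ _          = tt
off⇒constantTrace⊨ (lit ℓ) k _ A∈ℓ        = A∈ℓ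
off⇒constantTrace⊨ (φ ∧ ψ) k d (Aφ , Aψ)  =
  off⇒constantTrace⊨ φ k (m⊔n≤o⇒m≤o _ _ d) Aφ , off⇒constantTrace⊨ ψ k (m⊔n≤o⇒n≤o _ _ d) Aψ
off⇒constantTrace⊨ (φ ∨ ψ) k d (inj₁ Aφ)  = inj₁ (off⇒constantTrace⊨ φ k (m⊔n≤o⇒m≤o _ _ d) Aφ)
off⇒constantTrace⊨ (φ ∨ ψ) k d (inj₂ Aψ)  = inj₂ (off⇒constantTrace⊨ ψ k (m⊔n≤o⇒n≤o _ _ d) Aψ)
off⇒constantTrace⊨ (X φ)  (suc k) (s≤s d) Aφ = s≤s (s≤s z≤n) , off⇒constantTrace⊨ φ k d Aφ
off⇒constantTrace⊨ (Xw φ) (suc k) (s≤s d) Aφ = inj₂ (s≤s (s≤s z≤n) , off⇒constantTrace⊨ φ k d Aφ)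
off⇒constantTrace⊨ (φ U ψ) k d Aψ         = 0 , s≤s z≤n , off⇒constantTrace⊨ ψ k d Aψ , λ _ ()
off⇒constantTrace⊨ (φ R ψ) k _ Aψ         = ofr⇒constantTrace⊨ (φ R ψ) k Aψ

theorem4 : (n : ℕ) (φ : Form n) → Σ (Letter n) (λ A → A ⊨L off φ) → Satisfiable φ
theorem4 n φ (A , A⊨offφ) = constantTrace A (nextDepth φ) , off⇒constantTrace⊨ φ (nextDepth φ) ≤-refl A⊨offφ
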